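{- Let $\Psi$ be an $\mathrm{LTLf}^+$ or $\mathrm{PPLTL}^+$ formula in positive normal form, written as $\Psi=\widehat\Psi[i\mapsto \mathbb{Q}_i\Phi_i]_{i\in[k]}$, where $\widehat\Psi$ is a negation-free Boolean formula over variables $[k]=\{1,\dots,k\}$ (using $\wedge,\vee$), $\mathbb{Q}_i\in\{\forall,\exists,\exists^\infty,\forall^\infty\}$ and each $\Phi_i$ is a finite-trace formula. For each $i\in[k]$ let $\mathcal{A}_i=(D_i,F_i)$, $D_i=(\Sigma,Q_i,\iota_i,\delta_i)$, be a DFA with language exactly $[\Phi_i]$ whose initial state has no incoming transitions, and let $D'_i=(\Sigma,Q_i,\iota_i,\delta'_i)$ and $F'_i$ be obtained as follows: if $\mathbb{Q}_i\in\{\exists^\infty,\forall^\infty\}$, $\delta'_i=\delta_i$ and $F'_i=F_i$; if $\mathbb{Q}_i=\forall$, $F'_i=F_i\cup\{\iota_i\}$ and $\delta'_i(q,a)=q$ for $q\notin F'_i$, $\delta'_i(q,a)=\delta_i(q,a)$ otherwise; if $\mathbb{Q}_i=\exists$, $F'_i=F_i\setminus\{\iota_i\}$ and $\delta'_i(q,a)=q$ for $q\in F'_i$, $\delta'_i(q,a)=\delta_i(q,a)$ otherwise. Call $q_i\in Q_i$ marked if either $\mathbb{Q}_i\neq\forall^\infty$ and $q_i\in F'_i$, or $\mathbb{Q}_i=\forall^\infty$ and $q_i\in Q_i\setminus F'_i$. Let $D=\prod_{i\in[k]}D'_i$ with state set $Q$, and define the Emerson-Lei condition $(\Gamma,\lambda,B)$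 on $Q$ by $\Gamma=[k]$, $\lambda((q_1,\dots,q_k))=\{i\in[k]: q_i\text{ is marked}\}$, and $B$ obtained from $\widehat\Psi$ by simultaneously replacing every occurrence of each variable $i$ with $\mathbb{Q}_i=\forall^\infty$ by $\neg i$. Then $\Psi$ is equivalent to the deterministic Emerson-Lei automaton $\mathcal{A}_\Psi=(D,(\Gamma,\lambda,B))$: for every infinite trace $\tau$, $\tau\in[\Psi]$ iff the run induced by $\tau$ in $D$ satisfies $(\Gamma,\lambda,B)$.
   Context: $AP$ is a finite nonempty set of atoms, $\Sigma=2^{AP}$; traces are nonempty finite or infinite sequences over $\Sigma$. LTLf (future operators $X,U$, evaluated at position 0) and PPLTL (past operators $Y,S$, evaluated at the last position) are the standard linear temporal logics on finite traces; $[\Phi]$ is the set of finite traces satisfying $\Phi$. For a set $Z$ of finite traces: $\forall Z$ / $\exists Z$ / $\exists^\infty Z$ / $\forall^\infty Z$ is the set of infinite traces all / some / infinitely many / all but finitely many of whose nonempty finite prefixes lie in $Z$. $\mathrm{LTLf}^+$ (resp. $\mathrm{PPLTL}^+$) formulas are Boolean combinations (with $\wedge,\vee,\neg$) of formulas $\mathbb{Q}\Phi$ with $\Phi$ in LTLf (resp. PPLTL), with $[\mathbb{Q}\Phi]=\mathbb{Q}[\Phi]$ and Boolean connectives interpreted set-theoretically in $(2^{AP})^\omega$; positive normal form means no $\neg$ at this outer level. Deterministic transition systems are total; a DFA accepts a finite trace iff its run ends in a final state. The product of deterministic transition systems runs them componentwise in parallel. An Emerson-Lei condition $(\Gamma,\lambda,B)$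 over $Q$ has a finite label set $\Gamma$, a labeling $\lambda:Q\to2^\Gamma$ and a Boolean function $B:2^\Gamma\to\{\mathsf{true},\mathsf{false}\}$; an infinite run $\rho$ satisfies it iff $B(\bigcup\{\lambda(q):q\in\inf(\rho)\})=\mathsf{true}$, where $\inf(\rho)$ is the set of states occurring infinitely often in $\rho$. -}

module Defs where

open import Data.Nat using (ℕ; zero; suc; _≤_; _<_)
open import Data.Fin using (Fin; _≟_)
open import Data.Bool using (Bool; true; false; _∧_; _∨_; not; if_then_else_)
open import Data.Product using (Σ; _×_; ∃; ∃-syntax; _,_)
open import Data.Sum using (_⊎_)
open import Relation.Nullary using (¬_)
open import Data.Empty using (⊥)
open import Relation.Nullary.Decidable using (⌊_⌋)
open import Relation.Binary.PropositionalEquality using (_≡_; _≢_)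

-- Alphabet: AP = Fin n (finite, nonempty when 1 ≤ n), Σ = 2^AP

Letter : ℕ → Set
Letter n = Fin n → Bool

ITrace : ℕ → Set
ITrace n = ℕ → Letter n

-- Nonempty finite traces: positions 0 .. len (length = suc len).
-- Only the letters at positions 0 .. len are meaningful; all notions
-- below only read those positions.
record FTrace (n : ℕ) : Set where
  constructor ftrace
  field
    len : ℕ
    tr  : ℕ → Letter n
open FTrace public

prefix : ∀ {n} → ITrace n → ℕ → FTrace n
prefix τ m = ftrace m τ

data Logic : Set where
  ltlf ppltl : Logic

data Formula (n : ℕ) : Logic → Set where
  atom : ∀ {L} → Fin n → Formula n L
  ¬F   : ∀ {L} → Formula n L → Formula n L
  _∧F_ : ∀ {L} → Formula n L → Formula n L → Formula n L
  _∨F_ : ∀ {L} → Formula n L → Formula n L → Formula n L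
  X    : Formula n ltlf → Formula n ltlf
  _U_  : Formula n ltlf → Formula n ltlf → Formula n ltlf
  Y    : Formula n ppltl → Formula n ppltl
  _S_  : Formula n ppltl → Formula n ppltl → Formula n ppltl

-- satisfaction at position i (assumed i ≤ len w)
Holds : ∀ {n L} → FTrace n → ℕ → Formula n L → Set
Holds w i (atom p) = tr w i p ≡ true
Holds w i (¬F φ)   = ¬ Holds w i φ
Holds w i (φ ∧F ψ) = Holds w i φ × Holds w i ψ
Holds w i (φ ∨F ψ) = Holds w i φ ⊎ Holds w i ψ
Holds w i (X φ)    = (suc i ≤ len w) × Holds w (suc i) φ
Holds w i (φ U ψ)  = Σ ℕ λ j → (i ≤ j) × (j ≤ len w) × Holds w j ψ
                       × (∀ l → i ≤ l → l < j → Holds w l φ)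
Holds w zero    (Y φ) = ⊥
Holds w (suc i) (Y φ) = Holds w i φ
Holds w i (φ S ψ)  = Σ ℕ λ j → (j ≤ i) × Holds w j ψ
                       × (∀ l → j < l → l ≤ i → Holds w l φ)

evalPos : ∀ {n} → Logic → FTrace n → ℕ
evalPos ltlf  w = 0
evalPos ppltl w = len w

_⊨_ : ∀ {n L} → FTrace n → Formula n L → Set
_⊨_ {L = L} w Φ = Holds w (evalPos L w) Φ

data Quant : Set where
  all ex infEx infAll : Quant

QSem : ∀ {n} → Quant → (FTrace n → Set) → ITrace n → Set
QSem all    Z τ = ∀ m → Z (prefix τ m)
QSem ex     Z τ = Σ ℕ λ m → Z (prefix τ m)
QSem infEx  Z τ = ∀ m → Σ ℕ λ m' → (m ≤ m') × Z (prefix τ m')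
QSem infAll Z τ = Σ ℕ λ m → ∀ m' → m ≤ m' → Z (prefix τ m')

isInfAll : Quant → Bool
isInfAll infAll = true
isInfAll _      = false

data PosBool (k : ℕ) : Set where
  var  : Fin k → PosBool k
  _∧P_ : PosBool k → PosBool k → PosBool k
  _∨P_ : PosBool k → PosBool k → PosBool k

evalP : ∀ {k} → PosBool k → (Fin k → Set) → Set
evalP (var i)  v = v i
evalP (a ∧P b) v = evalP a v × evalP b v
evalP (a ∨P b) v = evalP a v ⊎ evalP b v

data BoolF (k : ℕ) : Set where
  bvar : Fin k → BoolF k
  bneg : BoolF k → BoolF k
  band : BoolF k → BoolF k → BoolF k
  bor  : BoolF k → BoolF k → BoolF k

evalB : ∀ {k} → BoolF k → (Fin k → Set) → Set
evalB (bvar i)   Sₗ = Sₗ i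
evalB (bneg a)   Sₗ = ¬ evalB a Sₗ
evalB (band a b) Sₗ = evalB a Sₗ × evalB b Sₗ
evalB (bor a b)  Sₗ = evalB a Sₗ ⊎ evalB b Sₗ

⟦_⟧Ψ : ∀ {n k L} → PosBool k × (Fin k → Quant) × (Fin k → Formula n L)
       → ITrace n → Set
⟦ (Ψ̂ , Q , Φ) ⟧Ψ τ =
  evalP Ψ̂ (λ i → QSem (Q i) (λ w → w ⊨ Φ i) τ)

record DFA (n : ℕ) : Set where
  field
    size : ℕ
    ι    : Fin size
    δ    : Fin size → Letter n → Fin size
    F    : Fin size → Bool
open DFA public

runD : ∀ {n s} → Fin s → (Fin s → Letter n → Fin s) → (ℕ → Letter n) → ℕ → Fin s
runD q0 d w zero    = q0
runD q0 d w (suc j) = d (runD q0 d w j) (w j)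

Accepts : ∀ {n} → DFA n → FTrace n → Set
Accepts A w = F A (runD (ι A) (δ A) (tr w) (suc (len w))) ≡ true

NoIncomingInit : ∀ {n} → DFA n → Set
NoIncomingInit A = ∀ q a → δ A q a ≢ ι A

isInit : ∀ {n} (A : DFA n) → Fin (size A) → Bool
isInit A q = ⌊ q ≟ ι A ⌋

F' : ∀ {n} → Quant → (A : DFA n) → Fin (size A) → Bool
F' all    A q = F A q ∨ isInit A q
F' ex     A q = F A q ∧ not (isInit A q)
F' infEx  A q = F A q
F' infAll A q = F A q

δ' : ∀ {n} → Quant → (A : DFA n) → Fin (size A) → Letter n → Fin (size A)
δ' all    A q a = if F' all A q then δ A q a else q
δ' ex     A q a = if F' ex A q then q else δ A q a
δ' infEx  A q a = δ A q a
δ' infAll A q a = δ A q a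

marked : ∀ {n} → Quant → (A : DFA n) → Fin (size A) → Bool
marked infAll A q = not (F' infAll A q)
marked Q      A q = F' Q A q

ProdState : ∀ {n k} → (Fin k → DFA n) → Set
ProdState A = (i : _) → Fin (size (A i))

_≈Q_ : ∀ {n k} {A : Fin k → DFA n} → ProdState A → ProdState A → Set
p ≈Q q = ∀ i → p i ≡ q i

prodRun : ∀ {n k} (Q : Fin k → Quant) (A : Fin k → DFA n) → ITrace n
          → ℕ → ProdState A
prodRun Q A τ zero    i = ι (A i)
prodRun Q A τ (suc j) i = δ' (Q i) (A i) (prodRun Q A τ j i) (τ j)

InfOften : ∀ {n k} {A : Fin k → DFA n} → (ℕ → ProdState A) → ProdState A → Set
InfOften {A = A} ρ q = ∀ m → Σ ℕ λ m' → (m ≤ m') × (_≈Q_ {A = A} (ρ m') q)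

labels : ∀ {n k} (Q : Fin k → Quant) (A : Fin k → DFA n) → ProdState A → Fin k → Set
labels Q A q i = marked (Q i) (A i) (q i) ≡ true

infLabels : ∀ {n k} (Q : Fin k → Quant) (A : Fin k → DFA n) → (ℕ → ProdState A)
            → Fin k → Set
infLabels Q A ρ i = Σ (ProdState A) λ q → InfOften {A = A} ρ q × labels Q A q i

toB : ∀ {k} → (Fin k → Quant) → PosBool k → BoolF k
toB Q (var i)  = if isInfAll (Q i) then bneg (bvar i) else bvar i
toB Q (a ∧P b) = band (toB Q a) (toB Q b)
toB Q (a ∨P b) = bor (toB Q a) (toB Q b)

ELAccepts : ∀ {n k} (Ψ̂ : PosBool k) (Q : Fin k → Quant) (A : Fin k → DFA n)
            → ITrace n → Set
ELAccepts Ψ̂ Q A τ = evalB (toB Q Ψ̂) (infLabels Q A (prodRun Q A τ))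

-- Each atom 𝕈ᵢΦᵢ is decided by the i-th component of the product run alone.
-- For ∃^∞ and ∀^∞ the component is the DFA itself: prefixes are accepted
-- infinitely often iff marked states recur, and almost always iff unmarked
-- states do not recur.  For ∃ (resp. ∀) the modified DFA freezes in the first
-- state inside (resp. outside) F'ᵢ, so it agrees with the DFA until then and
-- is constant afterwards; an accepting prefix exists (resp. all prefixes are
-- accepting) iff such a freeze happens (resp. never happens), iff marked
-- states recur.  The initial state only ever describes the empty prefix, as it
-- has no incoming transitions; that is why it is removed from F'ᵢ for ∃ and
-- added for ∀.  By the infinite pigeonhole principle a component is marked
-- infinitely often iff some product state with that component marked recurs,
-- so the Emerson–Lei condition evaluates Ψ̂ on the truth values of the atoms.
module Submission where

open import Defs
open import Data.Nat using (ℕ; _≤_)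
open import Data.Fin using (Fin)
open import Data.Product using (_,_)
open import Function.Bundles using (_⇔_)
open import Level using (0ℓ)
open import Axiom.ExcludedMiddle using (ExcludedMiddle)

open import Axiom.DoubleNegationElimination using (DoubleNegationElimination; em⇒dne)
open import Data.Bool using (Bool; true; false; not; _∧_; _∨_; if_then_else_)
  renaming (_≟_ to _≟ᵇ_)
open import Data.Bool.Properties using (∧-identityʳ; ∧-zeroʳ; ∨-identityʳ; ∨-zeroʳ; ¬-not)
open import Data.Empty using (⊥-elim)
open import Data.Fin using (toℕ; fromℕ<; _≟_) renaming (zero to fzero; suc to fsuc)
open import Data.Fin.Properties using (toℕ-injective; toℕ<n; toℕ-fromℕ<)
open import Data.Nat using (zero; suc; _<_; _⊔_; _≤′_; ≤′-refl; ≤′-step; s≤s)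
open import Data.Nat.Properties
  using (≤-refl; ≤-trans; ≤-pred; ≤∧≢⇒<; m≤n⇒m≤1+n; m<n⇒m<1+n; n<1+n; n≮0; m≤m⊔n; m≤n⊔m; ≤⇒≤′)
open import Data.Product using (Σ; ∃; ∃-syntax; _×_; proj₂)
open import Data.Product.Function.NonDependent.Propositional using (_×-⇔_)
open import Data.Sum using (_⊎_; inj₁; inj₂)
open import Data.Sum.Function.Propositional using (_⊎-⇔_)
open import Function using (_∘_)
open import Function.Bundles using (mk⇔; Equivalence)
open import Function.Construct.Symmetry using (⇔-sym)
open import Function.Properties.Equivalence using (⇔-setoid)
open import Function.Related.TypeIsomorphisms using (¬-cong-⇔)
open import Relation.Nullary using (¬_; yes; no)
open import Relation.Unary using (Pred; Decidable; _∩_; ∁; _⊆_)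
open import Relation.Binary.PropositionalEquality using (_≡_; _≢_; refl; sym; trans; cong; subst)
open import Relation.Binary.Reasoning.Setoid (⇔-setoid 0ℓ)

open Equivalence using (to; from)

InfinitelyOften : Pred ℕ 0ℓ → Set
InfinitelyOften P = ∀ m → ∃[ m' ] m ≤ m' × P m'

Eventually : Pred ℕ 0ℓ → Set
Eventually P = ∃[ m ] ∀ m' → m ≤ m' → P m'

Persistent : Pred ℕ 0ℓ → Set
Persistent P = ∀ t → P t → P (suc t)

io-mono : ∀ {P P'} → P ⊆ P' → InfinitelyOften P → InfinitelyOften P'
io-mono P⊆P' io m = let m' , m≤m' , p = io m in m' , m≤m' , P⊆P' p

io-cong : ∀ {P P'} → (∀ m → P m ⇔ P' m) → InfinitelyOften P ⇔ InfinitelyOften P'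
io-cong P⇔P' = mk⇔ (io-mono (to (P⇔P' _))) (io-mono (from (P⇔P' _)))

io-suc : ∀ {P} → InfinitelyOften (P ∘ suc) ⇔ InfinitelyOften P
io-suc {P} = mk⇔ shiftUp shiftDown
  where
  shiftUp : InfinitelyOften (P ∘ suc) → InfinitelyOften P
  shiftUp io m = let m' , m≤m' , p = io m in suc m' , m≤n⇒m≤1+n m≤m' , p

  shiftDown : InfinitelyOften P → InfinitelyOften (P ∘ suc)
  shiftDown io m with io (suc m)
  ... | suc m' , s≤s m≤m' , p = m' , m≤m' , p

persists : ∀ {P} → Persistent P → ∀ {t t'} → t ≤′ t' → P t → P t'
persists step ≤′-refl           p = p
persists step (≤′-step t≤′t') p = step _ (persists step t≤′t' p)

io⇔∃ : ∀ {P} → Persistent P → InfinitelyOften P ⇔ ∃ P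
io⇔∃ {P} step = mk⇔ witness (λ (t , p) m → m ⊔ t , m≤m⊔n m t , persists step (≤⇒≤′ (m≤n⊔m m t)) p)
  where
  witness : InfinitelyOften P → ∃ P
  witness io = let t , _ , p = io 0 in t , p

io-true⇔∀-true : (b : ℕ → Bool) → Persistent (λ t → b t ≡ false) →
                 InfinitelyOften (λ t → b t ≡ true) ⇔ (∀ t → b t ≡ true)
io-true⇔∀-true b falsePersists = mk⇔ always (λ bTrue m → m , ≤-refl , bTrue m)
  where
  always : InfinitelyOften (λ t → b t ≡ true) → ∀ t → b t ≡ true
  always io t with b t in bt≡false
  ... | true  = refl
  ... | false with io t
  ...   | m , t≤m , bm≡true
        with trans (sym bm≡true) (persists falsePersists (≤⇒≤′ t≤m) bt≡false)
  ...     | ()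

∀-true⇔¬∃-false : (b : ℕ → Bool) → (∀ t → b t ≡ true) ⇔ (¬ (∃[ t ] b t ≡ false))
∀-true⇔¬∃-false b = mk⇔ noFalse always
  where
  noFalse : (∀ t → b t ≡ true) → ¬ (∃[ t ] b t ≡ false)
  noFalse bTrue (t , bt≡false) with trans (sym (bTrue t)) bt≡false
  ... | ()

  always : ¬ (∃[ t ] b t ≡ false) → ∀ t → b t ≡ true
  always noFalse t with b t in bt≡b
  ... | true  = refl
  ... | false = ⊥-elim (noFalse (t , bt≡b))

¬true⇔not-true : (b : Bool) → (¬ b ≡ true) ⇔ (not b ≡ true)
¬true⇔not-true true  = mk⇔ (λ b≢true → ⊥-elim (b≢true refl)) (λ ())
¬true⇔not-true false = mk⇔ (λ _ → refl) (λ _ ())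

module Classical (em : ExcludedMiddle 0ℓ) where

  private
    dne : DoubleNegationElimination 0ℓ
    dne = em⇒dne em

  io-split : ∀ {P Q} → InfinitelyOften P → ¬ InfinitelyOften (P ∩ Q) →
             InfinitelyOften (P ∩ ∁ Q)
  io-split io ¬io-PQ m = dne λ ¬later → ¬io-PQ λ m₀ →
    let m' , m⊔m₀≤m' , p = io (m ⊔ m₀) in
    m' , ≤-trans (m≤n⊔m m m₀) m⊔m₀≤m' , p ,
    dne (λ ¬q → ¬later (m' , ≤-trans (m≤m⊔n m m₀) m⊔m₀≤m' , p , ¬q))

  eventually⇔¬io-∁ : ∀ {P} → Eventually P ⇔ (¬ InfinitelyOften (∁ P))
  eventually⇔¬io-∁ = mk⇔
    (λ (m , ev) io → let m' , m≤m' , ¬p = io m in ¬p (ev m' m≤m'))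
    (λ ¬io → dne λ ¬ev → ¬io λ m → dne λ ¬later →
      ¬ev (m , λ m' m≤m' → dne λ ¬p → ¬later (m' , m≤m' , ¬p)))

  io-pigeonhole-ℕ : ∀ {P} s (f : ℕ → ℕ) → (∀ {m} → P m → f m < s) → InfinitelyOften P →
                    ∃[ j ] j < s × InfinitelyOften (λ m → P m × f m ≡ j)
  io-pigeonhole-ℕ zero f bound io = let m , _ , p = io 0 in ⊥-elim (n≮0 (bound p))
  io-pigeonhole-ℕ {P} (suc s) f bound io with em {InfinitelyOften (λ m → P m × f m ≡ s)}
  ... | yes io-s = s , n<1+n s , io-s
  ... | no ¬io-s =
    let j , j<s , io-j = io-pigeonhole-ℕ s f bound′ (io-split io ¬io-s)
    in j , m<n⇒m<1+n j<s , io-mono (λ ((p , _) , fm≡j) → p , fm≡j) io-j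
    where
    bound′ : ∀ {m} → (P ∩ ∁ (λ m → f m ≡ s)) m → f m < s
    bound′ (p , fm≢s) = ≤∧≢⇒< (≤-pred (bound p)) fm≢s

  io-pigeonhole-Fin : ∀ {P s} (f : ℕ → Fin s) → InfinitelyOften P →
                      ∃[ j ] InfinitelyOften (λ m → P m × f m ≡ j)
  io-pigeonhole-Fin {s = s} f io =
    let j , j<s , io-j = io-pigeonhole-ℕ s (toℕ ∘ f) (λ {m} _ → toℕ<n (f m)) io
    in fromℕ< j<s ,
       io-mono (λ (p , e) → p , toℕ-injective (trans e (sym (toℕ-fromℕ< j<s)))) io-j

  io-pigeonhole-Π : ∀ {P k} {s : Fin k → ℕ} (ρ : ℕ → (i : Fin k) → Fin (s i)) →
                    InfinitelyOften P →
                    Σ ((i : Fin k) → Fin (s i)) λ q → InfinitelyOften (λ m → P m × (∀ i → ρ m i ≡ q i))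
  io-pigeonhole-Π {k = zero}  ρ io = (λ ()) , io-mono (λ p → p , λ ()) io
  io-pigeonhole-Π {k = suc k} {s} ρ io =
    let j , io-j = io-pigeonhole-Fin (λ m → ρ m fzero) io
        q , io-q = io-pigeonhole-Π (λ m i → ρ m (fsuc i)) io-j
    in cons j q , io-mono (λ ((p , e₀) , e) → p , agree e₀ e) io-q
    where
    cons : Fin (s fzero) → ((i : Fin k) → Fin (s (fsuc i))) → (i : Fin (suc k)) → Fin (s i)
    cons j q fzero    = j
    cons j q (fsuc i) = q i

    agree : ∀ {m j q} → ρ m fzero ≡ j → (∀ i → ρ m (fsuc i) ≡ q i) →
            ∀ i → ρ m i ≡ cons j q i
    agree e₀ e fzero    = e₀
    agree e₀ e (fsuc i) = e i

if-true : ∀ {A : Set} {b} {x y : A} → b ≡ true → (if b then x else y) ≡ x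
if-true refl = refl

if-false : ∀ {A : Set} {b} {x y : A} → b ≡ false → (if b then x else y) ≡ y
if-false refl = refl

module TrappedRun {n s} (d d' : Fin s → Letter n → Fin s)
  {Trap : Pred (Fin s) 0ℓ} (trap? : Decidable Trap)
  (stays : ∀ {q} a → Trap q → d' q a ≡ q) (follows : ∀ {q} a → ¬ Trap q → d' q a ≡ d q a)
  (q₀ : Fin s) (w : ℕ → Letter n) where

  run run' : ℕ → Fin s
  run  = runD q₀ d w
  run' = runD q₀ d' w

  trap-persists : Persistent (Trap ∘ run')
  trap-persists t trapped = subst Trap (sym (stays (w t) trapped)) trapped

  agrees-or-trapped : ∀ t → run' t ≡ run t ⊎ ∃[ u ] Trap (run u) × run' t ≡ run u
  agrees-or-trapped zero = inj₁ refl
  agrees-or-trapped (suc t) with agrees-or-trapped t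
  ... | inj₂ (u , trapped , run't≡runu) =
    inj₂ (u , trapped , trans (stays (w t) (subst Trap (sym run't≡runu) trapped)) run't≡runu)
  ... | inj₁ run't≡runt with trap? (run t)
  ...   | yes trapped =
    inj₂ (t , trapped , trans (stays (w t) (subst Trap (sym run't≡runt) trapped)) run't≡runt)
  ...   | no free =
    inj₁ (trans (follows (w t) (free ∘ subst Trap run't≡runt)) (cong (λ q → d q (w t)) run't≡runt))

  ∃-trapped⇔ : ∃ (Trap ∘ run') ⇔ ∃ (Trap ∘ run)
  ∃-trapped⇔ = mk⇔ fromRun' toRun'
    where
    fromRun' : ∃ (Trap ∘ run') → ∃ (Trap ∘ run)
    fromRun' (t , trapped) with agrees-or-trapped t
    ... | inj₁ run't≡runt       = t , subst Trap run't≡runt trapped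
    ... | inj₂ (u , trappedU , _) = u , trappedU

    toRun' : ∃ (Trap ∘ run) → ∃ (Trap ∘ run')
    toRun' (t , trapped) with agrees-or-trapped t
    ... | inj₁ run't≡runt                = t , subst Trap (sym run't≡runt) trapped
    ... | inj₂ (u , trappedU , run't≡runu) = t , subst Trap (sym run't≡runu) trappedU

isInit-ι : ∀ {n} (A : DFA n) → isInit A (ι A) ≡ true
isInit-ι A with ι A ≟ ι A
... | yes _   = refl
... | no ι≢ι = ⊥-elim (ι≢ι refl)

isInit-nonInit : ∀ {n} (A : DFA n) {q} → q ≢ ι A → isInit A q ≡ false
isInit-nonInit A {q} q≢ι with q ≟ ι A
... | yes q≡ι = ⊥-elim (q≢ι q≡ι)
... | no _    = refl

module _ {n} (A : DFA n) where

  F'-ex-ι : F' ex A (ι A) ≡ false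
  F'-ex-ι = trans (cong (λ b → F A (ι A) ∧ not b) (isInit-ι A)) (∧-zeroʳ _)

  F'-ex-nonInit : ∀ {q} → q ≢ ι A → F' ex A q ≡ F A q
  F'-ex-nonInit {q} q≢ι = trans (cong (λ b → F A q ∧ not b) (isInit-nonInit A q≢ι)) (∧-identityʳ _)

  F'-all-ι : F' all A (ι A) ≡ true
  F'-all-ι = trans (cong (F A (ι A) ∨_) (isInit-ι A)) (∨-zeroʳ _)

  F'-all-nonInit : ∀ {q} → q ≢ ι A → F' all A q ≡ F A q
  F'-all-nonInit {q} q≢ι = trans (cong (F A q ∨_) (isInit-nonInit A q≢ι)) (∨-identityʳ _)

run' : ∀ {n} → Quant → (A : DFA n) → ITrace n → ℕ → Fin (size A)
run' Q A = runD (ι A) (δ' Q A)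

MarkedInfinitelyOften : ∀ {n} → Quant → DFA n → ITrace n → Set
MarkedInfinitelyOften Q A τ = InfinitelyOften (λ m → marked Q A (run' Q A τ m) ≡ true)

Signed : Quant → Set → Set
Signed Q P = if isInfAll Q then ¬ P else P

signed-cong : ∀ Q {P P'} → P ⇔ P' → Signed Q P ⇔ Signed Q P'
signed-cong Q P⇔P' with isInfAll Q
... | true  = ¬-cong-⇔ P⇔P'
... | false = P⇔P'

module _ {n} (A : DFA n) (τ : ITrace n) where

  private
    run : ℕ → Fin (size A)
    run = runD (ι A) (δ A) τ

    Accepting : Pred ℕ 0ℓ
    Accepting m = F A (run m) ≡ true

  QSem-infEx-accepts⇔ : QSem infEx (Accepts A) τ ⇔ MarkedInfinitelyOften infEx A τ
  QSem-infEx-accepts⇔ = io-suc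

  QSem-infAll-accepts⇔ : ExcludedMiddle 0ℓ →
                         QSem infAll (Accepts A) τ ⇔ (¬ MarkedInfinitelyOften infAll A τ)
  QSem-infAll-accepts⇔ em = begin
    Eventually (Accepting ∘ suc)              ≈⟨ Classical.eventually⇔¬io-∁ em ⟩
    (¬ InfinitelyOften (∁ (Accepting ∘ suc))) ≈⟨ ¬-cong-⇔ io-suc ⟩
    (¬ InfinitelyOften (∁ Accepting))         ≈⟨ ¬-cong-⇔ (io-cong (¬true⇔not-true ∘ F A ∘ run)) ⟩
    (¬ MarkedInfinitelyOften infAll A τ)      ∎

  QSem-ex-accepts⇔ : NoIncomingInit A → QSem ex (Accepts A) τ ⇔ MarkedInfinitelyOften ex A τ
  QSem-ex-accepts⇔ noInc = begin
    ∃ (Accepting ∘ suc)                      ≈⟨ ⇔-sym ex-marked⇔ ⟩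
    (∃[ t ] F' ex A (run t) ≡ true)          ≈⟨ ⇔-sym Ex.∃-trapped⇔ ⟩
    (∃[ t ] F' ex A (run' ex A τ t) ≡ true)  ≈⟨ ⇔-sym (io⇔∃ Ex.trap-persists) ⟩
    MarkedInfinitelyOften ex A τ             ∎
    where
    module Ex = TrappedRun (δ A) (δ' ex A) (λ q → F' ex A q ≟ᵇ true)
                  (λ _ → if-true) (λ _ → if-false ∘ ¬-not) (ι A) τ

    ex-marked⇔ : (∃[ t ] F' ex A (run t) ≡ true) ⇔ ∃ (Accepting ∘ suc)
    ex-marked⇔ = mk⇔ toAccepting fromAccepting
      where
      toAccepting : (∃[ t ] F' ex A (run t) ≡ true) → ∃ (Accepting ∘ suc)
      toAccepting (zero , marked-ι) with trans (sym marked-ι) (F'-ex-ι A)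
      ... | ()
      toAccepting (suc m , h) = m , trans (sym (F'-ex-nonInit A (noInc (run m) (τ m)))) h

      fromAccepting : ∃ (Accepting ∘ suc) → ∃[ t ] F' ex A (run t) ≡ true
      fromAccepting (m , h) = suc m , trans (F'-ex-nonInit A (noInc (run m) (τ m))) h

  QSem-all-accepts⇔ : NoIncomingInit A → QSem all (Accepts A) τ ⇔ MarkedInfinitelyOften all A τ
  QSem-all-accepts⇔ noInc = begin
    (∀ m → Accepting (suc m))                       ≈⟨ ⇔-sym all-marked⇔ ⟩
    (∀ t → F' all A (run t) ≡ true)                 ≈⟨ ∀-true⇔¬∃-false (F' all A ∘ run) ⟩
    (¬ (∃[ t ] F' all A (run t) ≡ false))           ≈⟨ ¬-cong-⇔ (⇔-sym All.∃-trapped⇔) ⟩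
    (¬ (∃[ t ] F' all A (run' all A τ t) ≡ false))  ≈⟨ ⇔-sym (∀-true⇔¬∃-false marks) ⟩
    (∀ t → F' all A (run' all A τ t) ≡ true)        ≈⟨ ⇔-sym (io-true⇔∀-true marks All.trap-persists) ⟩
    MarkedInfinitelyOften all A τ                   ∎
    where
    marks : ℕ → Bool
    marks = F' all A ∘ run' all A τ

    module All = TrappedRun (δ A) (δ' all A) (λ q → F' all A q ≟ᵇ false)
                   (λ _ → if-false) (λ _ → if-true ∘ ¬-not) (ι A) τ

    all-marked⇔ : (∀ t → F' all A (run t) ≡ true) ⇔ (∀ m → Accepting (suc m))
    all-marked⇔ = mk⇔ toAccepting fromAccepting
      where
      toAccepting : (∀ t → F' all A (run t) ≡ true) → ∀ m → Accepting (suc m)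
      toAccepting h m = trans (sym (F'-all-nonInit A (noInc (run m) (τ m)))) (h (suc m))

      fromAccepting : (∀ m → Accepting (suc m)) → ∀ t → F' all A (run t) ≡ true
      fromAccepting h zero    = F'-all-ι A
      fromAccepting h (suc m) = trans (F'-all-nonInit A (noInc (run m) (τ m))) (h m)

  QSem-accepts⇔ : ExcludedMiddle 0ℓ → NoIncomingInit A →
                  ∀ Q → QSem Q (Accepts A) τ ⇔ Signed Q (MarkedInfinitelyOften Q A τ)
  QSem-accepts⇔ em noInc all    = QSem-all-accepts⇔ noInc
  QSem-accepts⇔ em noInc ex     = QSem-ex-accepts⇔ noInc
  QSem-accepts⇔ em noInc infEx  = QSem-infEx-accepts⇔
  QSem-accepts⇔ em noInc infAll = QSem-infAll-accepts⇔ em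

QSem-mono : ∀ {n} Q {Z Z' : FTrace n → Set} {τ} → (∀ {w} → Z w → Z' w) → QSem Q Z τ → QSem Q Z' τ
QSem-mono all    Z⊆Z' h       = λ m → Z⊆Z' (h m)
QSem-mono ex     Z⊆Z' (m , z) = m , Z⊆Z' z
QSem-mono infEx  Z⊆Z' h       = io-mono Z⊆Z' h
QSem-mono infAll Z⊆Z' (m , h) = m , λ m' m≤m' → Z⊆Z' (h m' m≤m')

QSem-cong : ∀ {n} Q {Z Z' : FTrace n → Set} {τ} → (∀ w → Z w ⇔ Z' w) → QSem Q Z τ ⇔ QSem Q Z' τ
QSem-cong Q Z⇔Z' = mk⇔ (QSem-mono Q (to (Z⇔Z' _))) (QSem-mono Q (from (Z⇔Z' _)))

prodRun-component : ∀ {n k} (Q : Fin k → Quant) (A : Fin k → DFA n) τ t i →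
                    prodRun Q A τ t i ≡ run' (Q i) (A i) τ t
prodRun-component Q A τ zero    i = refl
prodRun-component Q A τ (suc t) i = cong (λ q → δ' (Q i) (A i) q (τ t)) (prodRun-component Q A τ t i)

infLabels⇔marked-io : ExcludedMiddle 0ℓ → ∀ {n k} (Q : Fin k → Quant) (A : Fin k → DFA n) τ i →
                      infLabels Q A (prodRun Q A τ) i ⇔ MarkedInfinitelyOften (Q i) (A i) τ
infLabels⇔marked-io em Q A τ i = mk⇔ toMarked fromMarked
  where
  Marked : Fin (size (A i)) → Set
  Marked q = marked (Q i) (A i) q ≡ true

  toMarked : infLabels Q A (prodRun Q A τ) i → MarkedInfinitelyOften (Q i) (A i) τ
  toMarked (q , q∈inf , marked-q) m =
    let m' , m≤m' , ρm'≈q = q∈inf m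
    in m' , m≤m' , subst Marked (trans (sym (ρm'≈q i)) (prodRun-component Q A τ m' i)) marked-q

  fromMarked : MarkedInfinitelyOften (Q i) (A i) τ → infLabels Q A (prodRun Q A τ) i
  fromMarked io =
    let q , io-q = Classical.io-pigeonhole-Π em (prodRun Q A τ)
                     (io-mono (λ {m} → subst Marked (sym (prodRun-component Q A τ m i))) io)
        _ , _ , marked-m , ρm≈q = io-q 0
    in q , io-mono proj₂ io-q , subst Marked (ρm≈q i) marked-m

evalP⇔evalB-toB : ∀ {k} (Q : Fin k → Quant) {V P : Fin k → Set} →
                  (∀ i → V i ⇔ Signed (Q i) (P i)) → ∀ Ψ̂ → evalP Ψ̂ V ⇔ evalB (toB Q Ψ̂) P
evalP⇔evalB-toB Q literal (var i) with isInfAll (Q i) | literal i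
... | true  | V⇔¬P = V⇔¬P
... | false | V⇔P  = V⇔P
evalP⇔evalB-toB Q literal (a ∧P b) = evalP⇔evalB-toB Q literal a ×-⇔ evalP⇔evalB-toB Q literal b
evalP⇔evalB-toB Q literal (a ∨P b) = evalP⇔evalB-toB Q literal a ⊎-⇔ evalP⇔evalB-toB Q literal b

proposition2 : ExcludedMiddle 0ℓ →
    (n : ℕ) → 1 ≤ n →
    (k : ℕ) (L : Logic) (Ψ̂ : PosBool k) (Q : Fin k → Quant)
    (Φ : Fin k → Formula n L) (A : Fin k → DFA n) →
    (∀ i (w : FTrace n) → Accepts (A i) w ⇔ (w ⊨ Φ i)) →
    (∀ i → NoIncomingInit (A i)) →
    (τ : ITrace n) → ⟦ (Ψ̂ , Q , Φ) ⟧Ψ τ ⇔ ELAccepts Ψ̂ Q A τ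
proposition2 em n _ k L Ψ̂ Q Φ A language noInc τ = evalP⇔evalB-toB Q literal Ψ̂
  where
  literal : ∀ i → QSem (Q i) (_⊨ Φ i) τ ⇔ Signed (Q i) (infLabels Q A (prodRun Q A τ) i)
  literal i = begin
    QSem (Q i) (_⊨ Φ i) τ                                ≈⟨ QSem-cong (Q i) (⇔-sym ∘ language i) ⟩
    QSem (Q i) (Accepts (A i)) τ                         ≈⟨ QSem-accepts⇔ (A i) τ em (noInc i) (Q i) ⟩
    Signed (Q i) (MarkedInfinitelyOften (Q i) (A i) τ)   ≈⟨ signed-cong (Q i) (⇔-sym (infLabels⇔marked-io em Q A τ i)) ⟩
    Signed (Q i) (infLabels Q A (prodRun Q A τ) i)       ∎
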